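{- Let $h \geq 2$ and let $X$ be a finite $B_{2h-1,h-1}$-subset of an abelian group $\Gamma$. If $a_1+\cdots+a_\ell = a'_1+\cdots+a'_\ell$ is a proper double representation of length $\ell \leq 2h-1$ in $X$, then $\ell = h$.
   Context: For a subset $A$ of an abelian group and integers $1 \leq k \leq h$, $A$ is a $B_{h,k}$-set if whenever $a_1,\ldots,a_h,a'_1,\ldots,a'_h \in A$ satisfy $a_1+\cdots+a_h = a'_1+\cdots+a'_h$, there exist sets $I, I' \subseteq \{1,\ldots,h\}$ with $|I|=|I'|=k$ and a bijection $\tau: I' \to I$ such that $a'_{i'} = a_{\tau(i')}$ for all $i' \in I'$. A double representation of length $\ell$ in $X$ is a sequence $a_1,\ldots,a_\ell,a'_1,\ldots,a'_\ell$ of (not necessarily distinct) elements of $X$ with $a_1+\cdots+a_\ell = a'_1+\cdots+a'_\ell$ such that $(a'_1,\ldots,a'_\ell)$ is not a permutation of $(a_1,\ldots,a_\ell)$. It is proper if $\{a_1,\ldots,a_\ell\} \cap \{a'_1,\ldots,a'_\ell\} = \emptyset$. -}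

module Defs where

open import Level using (Level; _⊔_)
open import Data.Nat using (ℕ; zero; suc)
open import Data.Fin using (Fin; zero; suc)
open import Data.Fin.Permutation using (Permutation′; _⟨$⟩ʳ_)
open import Data.List using (List)
open import Data.Product using (Σ; ∃; _×_; _,_)
open import Function using (_∘_)
open import Function.Definitions using (Injective)
open import Relation.Binary.PropositionalEquality using (_≡_)
open import Relation.Nullary using (¬_)
open import Algebra.Bundles using (AbelianGroup)
import Data.List.Membership.Setoid as SetoidMembership

module _ {c ℓ : Level} (G : AbelianGroup c ℓ) where
  open AbelianGroup G
  open SetoidMembership setoid using (_∈_)

  sumF : {n : ℕ} → (Fin n → Carrier) → Carrier
  sumF {zero}  a = ε
  sumF {suc n} a = a zero ∙ sumF (a ∘ suc)

  InX : List Carrier → {n : ℕ} → (Fin n → Carrier) → Set (c ⊔ ℓ)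
  InX X {n} a = ∀ i → a i ∈ X

  IsPermOf : {n : ℕ} → (Fin n → Carrier) → (Fin n → Carrier) → Set ℓ
  IsPermOf {n} a' a = Σ (Permutation′ n) λ σ → ∀ i → a' i ≈ a (σ ⟨$⟩ʳ i)

  -- B_{h,k}-set.  Subsets I, I' ⊆ {1..h} of size k together with a bijection
  -- τ : I' → I are encoded by injections f, f' : Fin k → Fin h with
  -- I = image f, I' = image f', τ (f' j) = f j.
  IsBhk : (h k : ℕ) → List Carrier → Set (c ⊔ ℓ)
  IsBhk h k X =
    (a a' : Fin h → Carrier) → InX X a → InX X a' → sumF a ≈ sumF a' →
    Σ (Fin k → Fin h) λ f → Σ (Fin k → Fin h) λ f' →
      Injective _≡_ _≡_ f × Injective _≡_ _≡_ f' × (∀ j → a' (f' j) ≈ a (f j))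

  IsDoubleRep : List Carrier → {n : ℕ} → (Fin n → Carrier) → (Fin n → Carrier) → Set (c ⊔ ℓ)
  IsDoubleRep X a a' = InX X a × InX X a' × sumF a ≈ sumF a' × ¬ IsPermOf a' a

  IsProper : {n : ℕ} → (Fin n → Carrier) → (Fin n → Carrier) → Set ℓ
  IsProper a a' = ∀ i j → ¬ (a i ≈ a' j)

-- Pad the two sides of a proper double representation of length ℓ to length
-- 2h - 1 = tℓ + r by repeating each side t times and appending r copies of a₁
-- to both.  The B_{2h-1,h-1} property then matches h - 1 entries of the right
-- side with entries of the left side; by properness no a'ᵢ can be matched, so
-- all matched entries lie in the padding and h - 1 ≤ r.  When ℓ ≠ h, t and r
-- can be chosen with r < h - 1 (division with remainder if ℓ < h, and t = 1 if
-- ℓ > h), a contradiction.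
module Submission where

open import Defs
open import Level using (Level)
open import Data.Nat using (ℕ; _≤_; _∸_; _*_)
open import Data.Fin using (Fin)
open import Data.List using (List)
open import Relation.Binary.PropositionalEquality using (_≡_; _≢_)
open import Algebra.Bundles using (AbelianGroup)

open import Data.Nat using (zero; suc; _+_; _<_; _≟_)
open import Data.Nat.Properties
  using (+-comm; +-suc; +-identityʳ; *-identityˡ; ≤-pred; <-≤-trans; <⇒≱; +-monoˡ-<;
         +-cancelˡ-<; m+[n∸m]≡n; <-cmp; module ≤-Reasoning)
open import Data.Nat.DivMod using (_/_; _%_; m≡m%n+[m/n]*n; m%n<n)
open import Data.Fin using (zero; suc; splitAt; _↑ʳ_)
open import Data.Fin.Properties using (splitAt⁻¹-↑ʳ; injective⇒≤)
import Data.Fin.Permutation as Permutation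
open import Data.Vec.Functional using (Vector; _++_; concat; replicate)
open import Data.Product using (∃; ∃₂; _×_; _,_; proj₁; proj₂)
open import Data.Sum using (inj₁; inj₂)
open import Data.Sum.Properties using ([,]-map)
open import Data.Empty using (⊥-elim)
open import Function using (_∘_)
open import Function.Definitions using (Injective)
open import Relation.Nullary using (¬_; yes; no)
open import Relation.Binary.Definitions using (tri<; tri≈; tri>)
import Relation.Binary.PropositionalEquality as ≡

module _ {c ℓ} (Γ : AbelianGroup c ℓ) where
  open AbelianGroup Γ
  open import Relation.Binary.Reasoning.Setoid setoid

  sumF-cong : ∀ {n} {u v : Vector Carrier n} → (∀ i → u i ≈ v i) → sumF Γ u ≈ sumF Γ v
  sumF-cong {zero}  u≈v = refl
  sumF-cong {suc n} u≈v = ∙-cong (u≈v zero) (sumF-cong (u≈v ∘ suc))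

  sumF-++ : ∀ {m n} (u : Vector Carrier m) (v : Vector Carrier n) →
            sumF Γ (u ++ v) ≈ sumF Γ u ∙ sumF Γ v
  sumF-++ {zero}  u v = sym (identityˡ _)
  sumF-++ {suc m} u v = begin
    u zero ∙ sumF Γ ((u ++ v) ∘ suc)       ≈⟨ ∙-congˡ (sumF-cong (reflexive ∘ [,]-map ∘ splitAt m)) ⟩
    u zero ∙ sumF Γ ((u ∘ suc) ++ v)       ≈⟨ ∙-congˡ (sumF-++ (u ∘ suc) v) ⟩
    u zero ∙ (sumF Γ (u ∘ suc) ∙ sumF Γ v) ≈⟨ assoc _ _ _ ⟨
    sumF Γ u ∙ sumF Γ v                    ∎

  concat-replicate-suc : ∀ {l} t (a : Vector Carrier l) i →
    concat (replicate (suc t) a) i ≡ (a ++ concat (replicate t a)) i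
  concat-replicate-suc {l} t a i with splitAt l i
  ... | inj₁ _ = ≡.refl
  ... | inj₂ _ = ≡.refl

  sumF-concat-replicate-cong : ∀ {l} t {a a′ : Vector Carrier l} → sumF Γ a ≈ sumF Γ a′ →
    sumF Γ (concat (replicate t a)) ≈ sumF Γ (concat (replicate t a′))
  sumF-concat-replicate-cong zero    a≈a′ = refl
  sumF-concat-replicate-cong (suc t) {a} {a′} a≈a′ = begin
    sumF Γ (concat (replicate (suc t) a))      ≈⟨ sumF-cong (reflexive ∘ concat-replicate-suc t a) ⟩
    sumF Γ (a ++ concat (replicate t a))       ≈⟨ sumF-++ a _ ⟩
    sumF Γ a ∙ sumF Γ (concat (replicate t a)) ≈⟨ ∙-cong a≈a′ (sumF-concat-replicate-cong t {a} {a′} a≈a′) ⟩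
    sumF Γ a′ ∙ sumF Γ (concat (replicate t a′)) ≈⟨ sumF-++ a′ _ ⟨
    sumF Γ (a′ ++ concat (replicate t a′))       ≈⟨ sumF-cong (reflexive ∘ concat-replicate-suc t a′) ⟨
    sumF Γ (concat (replicate (suc t) a′))       ∎

  InX-++ : ∀ {X m n} {u : Vector Carrier m} {v : Vector Carrier n} →
           InX Γ X u → InX Γ X v → InX Γ X (u ++ v)
  InX-++ {m = m} u∈X v∈X i with splitAt m i
  ... | inj₁ p = u∈X p
  ... | inj₂ q = v∈X q

  -- The matching supplied by the B_{m+r,k} property cannot use a position of
  -- u on the right, so it injects Fin k into the r positions of p.
  IsBhk⇒≤tail : ∀ {m r k X} → IsBhk Γ (m + r) k X →
    (L : Vector Carrier (m + r)) (u : Vector Carrier m) (p : Vector Carrier r) →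
    InX Γ X L → InX Γ X (u ++ p) → sumF Γ L ≈ sumF Γ (u ++ p) →
    (∀ i j → ¬ L i ≈ u j) → k ≤ r
  IsBhk⇒≤tail {m} {r} {k} B L u p L∈X R∈X sums disjoint
    with f , f′ , _ , f′-injective , matched ← B L (u ++ p) L∈X R∈X sums
    = injective⇒≤ tail-index-injective
    where
    tail-position : ∀ j → ∃ λ q → f′ j ≡ m ↑ʳ q
    tail-position j with splitAt m (f′ j) in eq | matched j
    ... | inj₁ i | u≈L = ⊥-elim (disjoint (f j) i (sym u≈L))
    ... | inj₂ q | _   = q , ≡.sym (splitAt⁻¹-↑ʳ eq)

    tail-index : Fin k → Fin r
    tail-index = proj₁ ∘ tail-position

    tail-index-injective : Injective _≡_ _≡_ tail-index
    tail-index-injective {x} {y} e = f′-injective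
      (≡.trans (proj₂ (tail-position x)) (≡.trans (≡.cong (m ↑ʳ_) e) (≡.sym (proj₂ (tail-position y)))))

  IsProper⇒≤remainder : ∀ {X l k} t r → IsBhk Γ (t * suc l + r) k X →
    (a a′ : Vector Carrier (suc l)) → InX Γ X a → InX Γ X a′ → sumF Γ a ≈ sumF Γ a′ →
    IsProper Γ a a′ → k ≤ r
  IsProper⇒≤remainder {l = l} t r B a a′ a∈X a′∈X a≈a′ proper =
    IsBhk⇒≤tail B (repeat a ++ padding) (repeat a′) padding
      (InX-++ {u = repeat a} (λ _ → a∈X _) (λ _ → a∈X zero))
      (InX-++ {u = repeat a′} (λ _ → a′∈X _) (λ _ → a∈X zero))
      padded-sums disjoint
    where
    repeat : Vector Carrier (suc l) → Vector Carrier (t * suc l)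
    repeat = concat ∘ replicate t

    padding : Vector Carrier r
    padding = replicate r (a zero)

    padded-sums : sumF Γ (repeat a ++ padding) ≈ sumF Γ (repeat a′ ++ padding)
    padded-sums = begin
      sumF Γ (repeat a ++ padding)          ≈⟨ sumF-++ (repeat a) padding ⟩
      sumF Γ (repeat a) ∙ sumF Γ padding    ≈⟨ ∙-congʳ (sumF-concat-replicate-cong t {a} {a′} a≈a′) ⟩
      sumF Γ (repeat a′) ∙ sumF Γ padding   ≈⟨ sumF-++ (repeat a′) padding ⟨
      sumF Γ (repeat a′ ++ padding)         ∎

    disjoint : ∀ i j → ¬ (repeat a ++ padding) i ≈ repeat a′ j
    disjoint i j with splitAt (t * suc l) i
    ... | inj₁ _ = proper _ _
    ... | inj₂ _ = proper zero _

2*h∸1≡h+[h∸1] : ∀ h → 2 * h ∸ 1 ≡ h + (h ∸ 1)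
2*h∸1≡h+[h∸1] zero    = ≡.refl
2*h∸1≡h+[h∸1] (suc k) = ≡.trans (+-suc k (k + 0)) (≡.cong (λ n → suc (k + n)) (+-identityʳ k))

∃-short-remainder : ∀ h l → suc l ≤ 2 * h ∸ 1 → suc l ≢ h →
  ∃₂ λ t r → t * suc l + r ≡ 2 * h ∸ 1 × r < h ∸ 1
∃-short-remainder (suc k) l ℓ≤N ℓ≢h with <-cmp (suc l) (suc k)
... | tri< ℓ<h _ _ = N / suc l , N % suc l ,
  ≡.trans (+-comm _ (N % suc l)) (≡.sym (m≡m%n+[m/n]*n N (suc l))) ,
  <-≤-trans (m%n<n N (suc l)) (≤-pred ℓ<h)
  where N = 2 * suc k ∸ 1
... | tri≈ _ ℓ≡h _ = ⊥-elim (ℓ≢h ℓ≡h)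
... | tri> _ _ h<ℓ = 1 , N ∸ suc l ,
  ≡.trans (≡.cong (_+ (N ∸ suc l)) (*-identityˡ (suc l))) (m+[n∸m]≡n ℓ≤N) ,
  +-cancelˡ-< (suc l) _ _ (begin-strict
    suc l + (N ∸ suc l)  ≡⟨ m+[n∸m]≡n ℓ≤N ⟩
    N                    ≡⟨ 2*h∸1≡h+[h∸1] (suc k) ⟩
    suc k + k            <⟨ +-monoˡ-< k h<ℓ ⟩
    suc l + k            ∎)
  where
  N = 2 * suc k ∸ 1
  open ≤-Reasoning

mainTheorem3 : {c ℓ′ : Level} (Γ : AbelianGroup c ℓ′) (h : ℕ) → 2 ≤ h →
    (X : List (AbelianGroup.Carrier Γ)) → IsBhk Γ (2 * h ∸ 1) (h ∸ 1) X →
    (ℓ : ℕ) → ℓ ≤ 2 * h ∸ 1 →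
    (a a' : Fin ℓ → AbelianGroup.Carrier Γ) →
    IsDoubleRep Γ X a a' → IsProper Γ a a' →
    ℓ ≡ h
mainTheorem3 Γ h _ X B zero _ a a′ (_ , _ , _ , ¬perm) _ = ⊥-elim (¬perm (Permutation.id , λ ()))
mainTheorem3 Γ h _ X B (suc l) ℓ≤N a a′ (a∈X , a′∈X , a≈a′ , _) proper with suc l ≟ h
... | yes ℓ≡h = ℓ≡h
... | no ℓ≢h with t , r , t*ℓ+r≡N , r<h∸1 ← ∃-short-remainder h l ℓ≤N ℓ≢h
  = ⊥-elim (<⇒≱ r<h∸1 (IsProper⇒≤remainder Γ t r B′ a a′ a∈X a′∈X a≈a′ proper))
  where
  B′ : IsBhk Γ (t * suc l + r) (h ∸ 1) X
  B′ = ≡.subst (λ N → IsBhk Γ N (h ∸ 1) X) (≡.sym t*ℓ+r≡N) B
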